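{- Let $p$ be an odd prime and let $a$ be a positive integer. Then for any $r\in\mathbb Z$, $$\sum_{\substack{0<k<p^a\\ k\equiv r\ (\mathrm{mod}\ p-1)}}\binom{2k}{k+1}\equiv\frac12\sum_{\substack{0<k<p^a\\ k\equiv r+1\ (\mathrm{mod}\ p-1)}}\binom{2k}k-\sum_{\substack{0<k<p^a\\ k\equiv r\ (\mathrm{mod}\ p-1)}}\binom{2k}k\pmod{p^2}$$ and $$\sum_{\substack{0<k<p^a\\ k\equiv r\ (\mathrm{mod}\ p-1)}}C_k\equiv2\sum_{\substack{0<k<p^a\\ k\equiv r\ (\mathrm{mod}\ p-1)}}\binom{2k}k-\frac12\sum_{\substack{0<k<p^a\\ k\equiv r+1\ (\mathrm{mod}\ p-1)}}\binom{2k}k\pmod{p^2}.$$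
   Context: $C_k=\binom{2k}k/(k+1)$ denotes the $k$-th Catalan number. -}

module Defs where

open import Data.Nat as ℕ using (ℕ; zero; suc)
open import Data.Nat.Combinatorics using (_C_)
open import Data.Nat.DivMod using (_/_)
open import Data.Integer as ℤ using (ℤ; +_; _-_; _+_; _*_)
open import Relation.Nullary.Decidable using (does)
open import Data.Integer.Divisibility.Signed using (_∣?_)
import Data.Integer.Divisibility.Signed as S
open import Data.Bool using (if_then_else_)

-- Catalan number C_k = binom(2k,k)/(k+1) (exact division in ℕ)
catalan : ℕ → ℕ
catalan k = ((2 ℕ.* k) C k) / suc k

sumRes : ℕ → ℤ → ℤ → (ℕ → ℤ) → ℤ
sumRes zero m r f = + 0
sumRes (suc n) m r f =
  sumRes n m r f + (if (n ℕ.≡ᵇ 0) then + 0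
                    else (if does (m ∣? ((+ n) - r)) then f n else + 0))

_≡[mod_]_ : ℤ → ℤ → ℤ → Set
x ≡[mod m ] y = m S.∣ (x - y)

module Submission where

-- Write B k = C(2k,k), D k = C(2k,k+1).  The theorem (with both sides
-- multiplied by 2, so that no division by 2 is needed) follows from three facts.
--
--  (1) Pointwise identities:  B (k+1) = 2 B k + 2 D k  and  B k = C_k + D k,
--      hence  2 D k = B (k+1) - 2 B k  and  2 C_k = 4 B k - B (k+1).
--  (2) Index shift:  summing B (k+1) over 0 < k < N, k ≡ r (mod m) is the sum of
--      B k over 0 < k < N, k ≡ r+1, except that the term k = 1 is replaced by
--      k = N.  If N ≡ 1 (mod m) these two terms are selected together, so the
--      two sums agree modulo q as soon as B N ≡ B 1 (mod q).
--  (3) For a prime power N = p^a we have m = p-1 ∣ N-1, and B N ≡ 2 (mod p²):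
--      by Vandermonde B N = Σ_j C(N,j)·C(N,N-j), and p divides C(N,j) for
--      0 < j < N (absorption identity), so all but the two outer terms vanish.

open import Defs

module Binomial where

  open import Data.Nat using (ℕ; zero; suc; _+_; _*_; _∸_; _^_; _≤_; _<_; z≤n; s≤s; ≢-nonZero⁻¹)
  open import Data.Nat.Properties
  open import Data.Nat.Combinatorics using (_C_; nCk+nC[k+1]≡[n+1]C[k+1]; nCk≡nC[n∸k]; nCn≡1; nC1≡n)
  open import Data.Nat.DivMod using (_/_; m*n/n≡m)
  open import Data.Nat.Divisibility
  open import Data.Nat.Primality using (Prime; euclidsLemma; prime⇒nonZero)
  open import Data.Nat.Tactic.RingSolver using (solve-∀)
  open import Data.Product using (∃-syntax; _×_; _,_)
  open import Data.Sum using (inj₁; inj₂)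
  open import Relation.Nullary using (¬_; contradiction)
  open import Relation.Nullary.Decidable using (decidable-stable)
  open import Relation.Binary.PropositionalEquality
  open ≡-Reasoning

  central : ℕ → ℕ
  central k = (2 * k) C k

  nextToCentral : ℕ → ℕ
  nextToCentral k = (2 * k) C suc k

  pascal : ∀ n k → suc n C suc k ≡ n C k + n C suc k
  pascal n k = sym (nCk+nC[k+1]≡[n+1]C[k+1] n k)

  binomial-symmetry : ∀ i j → (i + j) C i ≡ (i + j) C j
  binomial-symmetry i j = trans (nCk≡nC[n∸k] (m≤m+n i j)) (cong ((i + j) C_) (m+n∸m≡n i j))

  absorption : ∀ n k → suc k * (suc n C suc k) ≡ suc n * (n C k)
  absorption n       zero    = trans (*-identityˡ (suc n C 1)) (trans (nC1≡n (suc n)) (sym (*-identityʳ (suc n))))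
  absorption zero    (suc k) = *-zeroʳ (suc (suc k))
  absorption (suc n) (suc k) = begin
      suc (suc k) * (suc (suc n) C suc (suc k))       ≡⟨ cong (suc (suc k) *_) (pascal (suc n) (suc k)) ⟩
      suc (suc k) * (X + Y)                           ≡⟨ rearrange (suc k) X Y ⟩
      X + (suc k * X + suc (suc k) * Y)               ≡⟨ cong₂ (λ u v → X + (u + v)) (absorption n k) (absorption n (suc k)) ⟩
      X + (suc n * (n C k) + suc n * (n C suc k))     ≡⟨ cong (X +_) (sym (*-distribˡ-+ (suc n) (n C k) (n C suc k))) ⟩
      X + suc n * (n C k + n C suc k)                 ≡⟨ cong (λ z → X + suc n * z) (sym (pascal n k)) ⟩
      suc (suc n) * X                                 ∎
    where
    X = suc n C suc k
    Y = suc n C suc (suc k)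
    rearrange : ∀ a x y → suc a * (x + y) ≡ x + (a * x + suc a * y)
    rearrange = solve-∀

  -- B (k+1) = 2 B k + 2 D k: Pascal twice, using C(2k+1,k) = C(2k+1,k+1).
  central-step : ∀ k → central (suc k) ≡ 2 * central k + 2 * nextToCentral k
  central-step k = begin
      (2 * suc k) C suc k                ≡⟨ cong (_C suc k) (double-suc k) ⟩
      suc X C suc k                      ≡⟨ pascal X k ⟩
      X C k + X C suc k                  ≡⟨ cong (_+ X C suc k) middle-symmetry ⟩
      X C suc k + X C suc k              ≡⟨ cong (X C suc k +_) (sym (+-identityʳ _)) ⟩
      2 * (X C suc k)                    ≡⟨ cong (2 *_) (pascal (2 * k) k) ⟩
      2 * (central k + nextToCentral k)  ≡⟨ *-distribˡ-+ 2 (central k) (nextToCentral k) ⟩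
      2 * central k + 2 * nextToCentral k ∎
    where
    X = suc (2 * k)
    double-suc : ∀ k → 2 * suc k ≡ suc (suc (2 * k))
    double-suc = solve-∀
    odd-split : ∀ k → suc (2 * k) ≡ k + suc k
    odd-split = solve-∀
    middle-symmetry : X C k ≡ X C suc k
    middle-symmetry = subst (λ n → n C k ≡ n C suc k) (sym (odd-split k)) (binomial-symmetry k (suc k))

  -- (k+1) D k = k B k, by absorption on both sides of C(2k+1,k) = C(2k+1,k+1).
  nextToCentral-ratio : ∀ k → suc k * nextToCentral k ≡ k * central k
  nextToCentral-ratio zero    = refl
  nextToCentral-ratio (suc k) = subst (λ N → suc (suc k) * (N C suc (suc k)) ≡ suc k * (N C suc k))
                                      (sym (double-suc k)) ratio
    where
    M = k + suc k
    double-suc : ∀ k → 2 * suc k ≡ suc (k + suc k)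
    double-suc = solve-∀
    ratio : suc (suc k) * (suc M C suc (suc k)) ≡ suc k * (suc M C suc k)
    ratio = begin
      suc (suc k) * (suc M C suc (suc k))  ≡⟨ absorption M (suc k) ⟩
      suc M * (M C suc k)                  ≡⟨ cong (suc M *_) (sym (binomial-symmetry k (suc k))) ⟩
      suc M * (M C k)                      ≡⟨ sym (absorption M k) ⟩
      suc k * (suc M C suc k)              ∎

  -- B k = C_k + D k: from (k+1) D = k B one gets D = k (B - D), so
  -- B = (k+1)(B - D) and the Catalan number is the exact quotient B - D.
  catalan-decomposition : ∀ k → central k ≡ catalan k + nextToCentral k
  catalan-decomposition k = begin
      B            ≡⟨ sym E+D≡B ⟩
      E + D        ≡⟨ cong (_+ D) (sym catalan≡E) ⟩
      catalan k + D ∎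
    where
    B = central k
    D = nextToCentral k
    E = B ∸ D
    D≤B : D ≤ B
    D≤B = *-cancelˡ-≤ (suc k) (subst (_≤ suc k * B) (sym (nextToCentral-ratio k)) (m≤n+m (k * B) B))
    E+D≡B : E + D ≡ B
    E+D≡B = m∸n+n≡m D≤B
    D≡kE : D ≡ k * E
    D≡kE = +-cancelʳ-≡ (k * D) D (k * E)
             (trans (nextToCentral-ratio k) (trans (cong (k *_) (sym E+D≡B)) (*-distribˡ-+ k E D)))
    B≡E*[k+1] : B ≡ E * suc k
    B≡E*[k+1] = trans (sym E+D≡B) (trans (cong (E +_) D≡kE) (*-comm (suc k) E))
    catalan≡E : catalan k ≡ E
    catalan≡E = trans (cong (_/ suc k) B≡E*[k+1]) (m*n/n≡m E (suc k))

  prime-power-∣-cofactor : ∀ {p} → Prime p → ∀ b j x → p ^ b ∣ j * x → ¬ p ∣ x → p ^ b ∣ j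
  prime-power-∣-cofactor pr zero j x _ _ = 1∣ j
  prime-power-∣-cofactor {p} pr (suc b) j x p^[b+1]∣jx p∤x
    with euclidsLemma j x pr (∣-trans (m∣m*n (p ^ b)) p^[b+1]∣jx)
  ... | inj₂ p∣x = contradiction p∣x p∤x
  ... | inj₁ (divides q refl) =
    subst (p * p ^ b ∣_) (*-comm p q) (*-monoʳ-∣ p (prime-power-∣-cofactor pr b q x p^b∣qx p∤x))
    where
    instance _ = prime⇒nonZero pr
    regroup : ∀ q p x → q * p * x ≡ p * (q * x)
    regroup = solve-∀
    p^b∣qx : p ^ b ∣ q * x
    p^b∣qx = *-cancelˡ-∣ p (subst (p * p ^ b ∣_) (regroup q p x) p^[b+1]∣jx)

  -- For a prime power N = p^a, p divides C(N, j) whenever 0 < j < N: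
  -- otherwise j C(N,j) = N C(N-1,j-1) would force p^a ∣ j.
  prime∣binomial : ∀ {p} a → Prime p → ∀ {N j} → p ^ a ≡ N → 0 < j → j < N → p ∣ N C j
  prime∣binomial {p} a pr {suc N} {suc j} p^a≡N _ j<N =
    decidable-stable (p ∣? (suc N C suc j)) λ p∤ →
      <⇒≱ j<N (subst (_≤ suc j) p^a≡N (∣⇒≤ (prime-power-∣-cofactor pr a (suc j) _ p^a∣ p∤)))
    where
    p^a∣ : p ^ a ∣ suc j * (suc N C suc j)
    p^a∣ = subst (p ^ a ∣_) (sym (absorption N j))
             (subst (_∣ suc N * (N C j)) (sym p^a≡N) (m∣m*n _))

  Σ≤ : ℕ → (ℕ → ℕ) → ℕ
  Σ≤ zero    f = f 0
  Σ≤ (suc k) f = f 0 + Σ≤ k (λ j → f (suc j))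

  Σ≤-cong : ∀ k {f g} → (∀ j → f j ≡ g j) → Σ≤ k f ≡ Σ≤ k g
  Σ≤-cong zero    f≡g = f≡g 0
  Σ≤-cong (suc k) f≡g = cong₂ _+_ (f≡g 0) (Σ≤-cong k (λ j → f≡g (suc j)))

  Σ≤-+ : ∀ k f g → Σ≤ k (λ j → f j + g j) ≡ Σ≤ k f + Σ≤ k g
  Σ≤-+ zero    f g = refl
  Σ≤-+ (suc k) f g = trans (cong (f 0 + g 0 +_) (Σ≤-+ k _ _)) (interchange (f 0) (g 0) _ _)
    where
    interchange : ∀ a b c d → a + b + (c + d) ≡ a + c + (b + d)
    interchange = solve-∀

  Σ≤-zero : ∀ k f → (∀ j → f j ≡ 0) → Σ≤ k f ≡ 0
  Σ≤-zero zero    f f≡0 = f≡0 0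
  Σ≤-zero (suc k) f f≡0 = cong₂ _+_ (f≡0 0) (Σ≤-zero k _ (λ j → f≡0 (suc j)))

  Σ≤-last : ∀ k f → Σ≤ (suc k) f ≡ Σ≤ k f + f (suc k)
  Σ≤-last zero    f = refl
  Σ≤-last (suc k) f = trans (cong (f 0 +_) (Σ≤-last k (λ j → f (suc j)))) (sym (+-assoc (f 0) _ _))

  Σ≤-∣ : ∀ d k f → (∀ j → j ≤ k → d ∣ f j) → d ∣ Σ≤ k f
  Σ≤-∣ d zero    f d∣f = d∣f 0 z≤n
  Σ≤-∣ d (suc k) f d∣f = ∣m∣n⇒∣m+n (d∣f 0 z≤n) (Σ≤-∣ d k (λ j → f (suc j)) (λ j j≤k → d∣f (suc j) (s≤s j≤k)))

  vandermonde : ∀ m n k → (m + n) C k ≡ Σ≤ k (λ j → (m C j) * (n C (k ∸ j)))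
  vandermonde zero    n zero    = sym (+-identityʳ _)
  vandermonde zero    n (suc k) = sym (begin
      (n C suc k + 0) + Σ≤ k (λ j → (0 C suc j) * (n C (k ∸ j)))
        ≡⟨ cong₂ _+_ (+-identityʳ (n C suc k)) (Σ≤-zero k _ (λ _ → refl)) ⟩
      n C suc k + 0
        ≡⟨ +-identityʳ _ ⟩
      n C suc k ∎)
  vandermonde (suc m) n zero    = refl
  vandermonde (suc m) n (suc k) = begin
      suc (m + n) C suc k                                          ≡⟨ pascal (m + n) k ⟩
      (m + n) C k + (m + n) C suc k                                ≡⟨ cong₂ _+_ (vandermonde m n k) (vandermonde m n (suc k)) ⟩
      Σ≤ k F + (1 * (n C suc k) + Σ≤ k G)                          ≡⟨ rearrange (Σ≤ k F) (n C suc k) (Σ≤ k G) ⟩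
      1 * (n C suc k) + (Σ≤ k F + Σ≤ k G)                          ≡⟨ cong (1 * (n C suc k) +_) (sym (Σ≤-+ k F G)) ⟩
      1 * (n C suc k) + Σ≤ k (λ j → F j + G j)                     ≡⟨ cong (1 * (n C suc k) +_) (Σ≤-cong k merge) ⟩
      1 * (n C suc k) + Σ≤ k (λ j → (suc m C suc j) * (n C (k ∸ j))) ∎
    where
    F = λ j → (m C j) * (n C (k ∸ j))
    G = λ j → (m C suc j) * (n C (k ∸ j))
    rearrange : ∀ a b c → a + (1 * b + c) ≡ 1 * b + (a + c)
    rearrange = solve-∀
    merge : ∀ j → F j + G j ≡ (suc m C suc j) * (n C (k ∸ j))
    merge j = trans (sym (*-distribʳ-+ (n C (k ∸ j)) (m C j) (m C suc j)))
                    (cong (_* (n C (k ∸ j))) (sym (pascal m j)))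

  -- By Vandermonde B N = Σ_{j ≤ N} C(N,j) C(N,N-j); the outer terms are 1 and
  -- each inner term is a product of two binomials divisible by p.
  central-prime-power : ∀ {p} a → Prime p → ∃[ M ] p ^ 2 ∣ M × central (p ^ a) ≡ 2 + M
  central-prime-power {p} a pr with p ^ a in p^a≡N
  ... | zero        = contradiction p^a≡N (≢-nonZero⁻¹ (p ^ a) {{m^n≢0 p a {{prime⇒nonZero pr}}}})
  ... | suc zero    = 0 , (p ^ 2) ∣0 , refl
  ... | suc (suc n) = M , p²∣M , B≡2+M
    where
    N = suc (suc n)
    term : ℕ → ℕ
    term j = (N C j) * (N C (N ∸ j))
    M = Σ≤ n (λ j → term (suc j))
    B≡2+M : central N ≡ 2 + M
    B≡2+M = begin
      (2 * N) C N                                  ≡⟨ cong (λ z → (N + z) C N) (+-identityʳ N) ⟩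
      (N + N) C N                                  ≡⟨ vandermonde N N N ⟩
      term 0 + Σ≤ (suc n) (λ j → term (suc j))     ≡⟨ cong (term 0 +_) (Σ≤-last n (λ j → term (suc j))) ⟩
      term 0 + (M + term N)                        ≡⟨ cong₂ (λ u v → u + (M + v)) outer-first outer-last ⟩
      1 + (M + 1)                                  ≡⟨ cong suc (+-comm M 1) ⟩
      2 + M                                        ∎
      where
      outer-first : term 0 ≡ 1
      outer-first = cong (1 *_) (nCn≡1 N)
      outer-last : term N ≡ 1
      outer-last = cong₂ _*_ (nCn≡1 N) (cong (N C_) (n∸n≡0 n))
    inner : ∀ {j} → 0 < j → j < N → p ∣ N C j
    inner = prime∣binomial a pr p^a≡N
    p²∣M : p ^ 2 ∣ M
    p²∣M = subst (_∣ M) (cong (p *_) (sym (*-identityʳ p)))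
      (Σ≤-∣ (p * p) n (λ j → term (suc j)) λ j j≤n →
        *-pres-∣ (inner (s≤s z≤n) (s≤s (s≤s j≤n)))
                 (subst (λ z → p ∣ N C z) (sym (+-∸-assoc 1 j≤n))
                        (inner (s≤s z≤n) (s≤s (s≤s (m∸n≤m n j))))))

module ResidueSums where

  open import Data.Nat using (zero; suc; _^_)
  import Data.Nat as ℕ
  open import Data.Integer using (ℤ; +_; _+_; _-_; _*_)
  open import Data.Integer.Properties using (*-zeroʳ; pos-+; pos-*)
  open import Data.Integer.Divisibility.Signed using (_∣_; divides; _∣?_; ∣-refl; ∣m∣n⇒∣m+n; ∣m∣n⇒∣m-n; ∣n⇒∣m*n)
  open import Data.Integer.Tactic.RingSolver using (solve-∀)
  open import Data.Bool using (Bool; true; false; if_then_else_)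
  open import Relation.Nullary using (Dec; yes; no; does; contradiction)
  open import Relation.Binary.PropositionalEquality
  open ≡-Reasoning

  ∣0 : ∀ d → d ∣ + 0
  ∣0 d = divides (+ 0) refl

  -- The summand sumRes adds at an index: zero when the index is 0 (flag b)
  -- or lies outside the residue class (flag c false), the value x otherwise.
  guarded : Bool → Bool → ℤ → ℤ
  guarded b c x = if b then + 0 else (if c then x else + 0)

  guarded-- : ∀ b c x y → guarded b c (x - y) ≡ guarded b c x - guarded b c y
  guarded-- true  c     x y = refl
  guarded-- false true  x y = refl
  guarded-- false false x y = refl

  guarded-* : ∀ b c a x → guarded b c (a * x) ≡ a * guarded b c x
  guarded-* true  c     a x = sym (*-zeroʳ a)
  guarded-* false true  a x = refl
  guarded-* false false a x = sym (*-zeroʳ a)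

  guarded-∣ : ∀ {d x} b c → d ∣ x → d ∣ guarded b c x
  guarded-∣ {d} true  c     d∣x = ∣0 d
  guarded-∣     false true  d∣x = d∣x
  guarded-∣ {d} false false d∣x = ∣0 d

  sumRes-cong : ∀ n m r {f g} → (∀ k → f k ≡ g k) → sumRes n m r f ≡ sumRes n m r g
  sumRes-cong zero    m r f≡g = refl
  sumRes-cong (suc n) m r f≡g =
    cong₂ _+_ (sumRes-cong n m r f≡g) (cong (guarded (n ℕ.≡ᵇ 0) (does (m ∣? (+ n - r)))) (f≡g n))

  sumRes-- : ∀ n m r f g → sumRes n m r (λ k → f k - g k) ≡ sumRes n m r f - sumRes n m r g
  sumRes-- zero    m r f g = refl
  sumRes-- (suc n) m r f g = begin
      sumRes n m r (λ k → f k - g k) + guarded b c (f n - g n)  ≡⟨ cong₂ _+_ (sumRes-- n m r f g) (guarded-- b c (f n) (g n)) ⟩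
      (sumRes n m r f - sumRes n m r g) + (guarded b c (f n) - guarded b c (g n))
                                                                ≡⟨ interchange (sumRes n m r f) (sumRes n m r g) _ _ ⟩
      (sumRes n m r f + guarded b c (f n)) - (sumRes n m r g + guarded b c (g n)) ∎
    where
    b = n ℕ.≡ᵇ 0
    c = does (m ∣? (+ n - r))
    interchange : ∀ a b c d → (a - b) + (c - d) ≡ (a + c) - (b + d)
    interchange = solve-∀

  sumRes-* : ∀ n m r a f → sumRes n m r (λ k → a * f k) ≡ a * sumRes n m r f
  sumRes-* zero    m r a f = sym (*-zeroʳ a)
  sumRes-* (suc n) m r a f =
    trans (cong₂ _+_ (sumRes-* n m r a f) (guarded-* (n ℕ.≡ᵇ 0) (does (m ∣? (+ n - r))) a (f n)))
          (factor a _ _)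
    where
    factor : ∀ a b c → a * b + a * c ≡ a * (b + c)
    factor = solve-∀

  same-residue-same-test : ∀ m x y → m ∣ x - y → does (m ∣? x) ≡ does (m ∣? y)
  same-residue-same-test m x y m∣x-y = decide-alike (m ∣? x) (m ∣? y)
    where
    x-[x-y]≡y : ∀ x y → x - (x - y) ≡ y
    x-[x-y]≡y = solve-∀
    [x-y]+y≡x : ∀ x y → (x - y) + y ≡ x
    [x-y]+y≡x = solve-∀
    decide-alike : (dx : Dec (m ∣ x)) (dy : Dec (m ∣ y)) → does dx ≡ does dy
    decide-alike (yes _)   (yes _)   = refl
    decide-alike (no _)    (no _)    = refl
    decide-alike (yes m∣x) (no m∤y)  = contradiction (subst (m ∣_) (x-[x-y]≡y x y) (∣m∣n⇒∣m-n m∣x m∣x-y)) m∤y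
    decide-alike (no m∤x)  (yes m∣y) = contradiction (subst (m ∣_) ([x-y]+y≡x x y) (∣m∣n⇒∣m+n m∣x-y m∣y)) m∤x

  sumRes-shift : ∀ m r f n →
    sumRes (suc (suc n)) m (r + + 1) f ≡
    sumRes (suc n) m r (λ k → f (suc k)) + guarded false (does (m ∣? (+ 1 - (r + + 1)))) (f 1)
  sumRes-shift m r f zero    = refl
  sumRes-shift m r f (suc n) =
    trans (cong₂ _+_ (sumRes-shift m r f n)
                     (cong (λ z → guarded false (does (m ∣? z)) (f (suc (suc n)))) (shift-class (+ suc n) r)))
          (swap (sumRes (suc n) m r (λ k → f (suc k))) _ _)
    where
    shift-class : ∀ (x r : ℤ) → (+ 1 + x) - (r + + 1) ≡ x - r
    shift-class = solve-∀
    swap : ∀ a b c → (a + b) + c ≡ (a + c) + b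
    swap = solve-∀

  shifted-sum-congruence : ∀ m q r f N → m ∣ + N - + 1 → q ∣ f N - f 1 →
    sumRes N m r (λ k → f (suc k)) ≡[mod q ] sumRes N m (r + + 1) f
  shifted-sum-congruence m q r f zero          _      _       = ∣0 q
  shifted-sum-congruence m q r f (suc zero)    _      _       = ∣0 q
  shifted-sum-congruence m q r f (suc (suc n)) m∣N-1 q∣fN-f1 =
    subst (q ∣_) (sym difference) (guarded-∣ false c q∣fN-f1)
    where
    S = sumRes (suc n) m r (λ k → f (suc k))
    c = does (m ∣? (+ 1 - (r + + 1)))
    realign : ∀ x r → (+ 1 + x) - + 1 ≡ (x - r) - (+ 1 - (r + + 1))
    realign = solve-∀
    same-class : does (m ∣? (+ suc n - r)) ≡ c
    same-class = same-residue-same-test m (+ suc n - r) (+ 1 - (r + + 1)) (subst (m ∣_) (realign (+ suc n) r) m∣N-1)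
    cancel : ∀ s x y → (s + x) - (s + y) ≡ x - y
    cancel = solve-∀
    difference : (S + guarded false (does (m ∣? (+ suc n - r))) (f (suc (suc n))))
                   - sumRes (suc (suc n)) m (r + + 1) f
                 ≡ guarded false c (f (suc (suc n)) - f 1)
    difference = begin
      (S + guarded false (does (m ∣? (+ suc n - r))) (f (suc (suc n)))) - sumRes (suc (suc n)) m (r + + 1) f
        ≡⟨ cong₂ (λ t u → (S + guarded false t (f (suc (suc n)))) - u) same-class (sumRes-shift m r f n) ⟩
      (S + guarded false c (f (suc (suc n)))) - (S + guarded false c (f 1))
        ≡⟨ cancel S _ _ ⟩
      guarded false c (f (suc (suc n))) - guarded false c (f 1)
        ≡⟨ sym (guarded-- false c _ _) ⟩
      guarded false c (f (suc (suc n)) - f 1) ∎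

  pred∣power-pred : ∀ n a → + n ∣ + (suc n ^ a) - + 1
  pred∣power-pred n zero    = ∣0 (+ n)
  pred∣power-pred n (suc a) =
    subst (+ n ∣_) (sym split) (∣m∣n⇒∣m+n (pred∣power-pred n a) (∣n⇒∣m*n (+ X) ∣-refl))
    where
    X = suc n ^ a
    regroup : ∀ x m → (x + m * x) - + 1 ≡ (x - + 1) + x * m
    regroup = solve-∀
    split : + (suc n ^ suc a) - + 1 ≡ (+ X - + 1) + + X * + n
    split = begin
      + (X ℕ.+ n ℕ.* X) - + 1      ≡⟨ cong (_- + 1) (trans (pos-+ X (n ℕ.* X)) (cong (λ z → + X + z) (pos-* n X))) ⟩
      (+ X + + n * + X) - + 1      ≡⟨ regroup (+ X) (+ n) ⟩
      (+ X - + 1) + + X * + n      ∎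

open import Data.Nat as ℕ using (ℕ; zero; suc; _^_; ≢-nonZero⁻¹)
open import Data.Nat.Combinatorics using (_C_)
open import Data.Nat.Primality using (Prime; prime⇒nonZero)
open import Data.Integer as ℤ using (ℤ; +_; _-_; _+_; _*_)
open import Data.Product using (_×_; _,_)
open import Relation.Nullary using (contradiction)
open import Data.Integer.Properties using (pos-+; pos-*)
open import Data.Integer.Divisibility.Signed using (_∣_; ∣ᵤ⇒∣; ∣m⇒∣-m)
open import Data.Integer.Tactic.RingSolver using (solve-∀)
open import Relation.Binary.PropositionalEquality using (_≡_; _≢_; refl; sym; trans; cong; cong₂; subst; module ≡-Reasoning)
open Binomial using (central; nextToCentral; central-step; catalan-decomposition; central-prime-power)
open ResidueSums

Bℤ : ℕ → ℤ
Bℤ k = + central k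

central-step-ℤ : ∀ k → Bℤ (suc k) ≡ + 2 * Bℤ k + + 2 * + nextToCentral k
central-step-ℤ k = trans (cong +_ (central-step k))
  (trans (pos-+ (2 ℕ.* central k) _) (cong₂ _+_ (pos-* 2 (central k)) (pos-* 2 (nextToCentral k))))

catalan-decomposition-ℤ : ∀ k → Bℤ k ≡ + catalan k + + nextToCentral k
catalan-decomposition-ℤ k = trans (cong +_ (catalan-decomposition k)) (pos-+ (catalan k) _)

twice-nextToCentral : ∀ k → + 2 * + nextToCentral k ≡ Bℤ (suc k) - + 2 * Bℤ k
twice-nextToCentral k = solve-for-D (Bℤ (suc k)) (Bℤ k) (+ nextToCentral k) (central-step-ℤ k)
  where
  solve-for-D : ∀ b' b d → b' ≡ + 2 * b + + 2 * d → + 2 * d ≡ b' - + 2 * b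
  solve-for-D _ b d refl = identity b d
    where
    identity : ∀ b d → + 2 * d ≡ (+ 2 * b + + 2 * d) - + 2 * b
    identity = solve-∀

twice-catalan : ∀ k → + 2 * + catalan k ≡ + 4 * Bℤ k - Bℤ (suc k)
twice-catalan k =
  solve-for-C (Bℤ (suc k)) (Bℤ k) (+ catalan k) (+ nextToCentral k) (central-step-ℤ k) (catalan-decomposition-ℤ k)
  where
  solve-for-C : ∀ b' b c d → b' ≡ + 2 * b + + 2 * d → b ≡ c + d → + 2 * c ≡ + 4 * b - b'
  solve-for-C _ _ c d refl refl = identity c d
    where
    identity : ∀ c d → + 2 * c ≡ + 4 * (c + d) - (+ 2 * (c + d) + + 2 * d)
    identity = solve-∀

residue-sum-identities : ∀ N m q r →
  sumRes N m r (λ k → Bℤ (suc k)) ≡[mod q ] sumRes N m (r + + 1) Bℤ →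
  ((+ 2) * sumRes N m r (λ k → + nextToCentral k))
    ≡[mod q ] (sumRes N m (r + + 1) Bℤ - (+ 2) * sumRes N m r Bℤ)
  ×
  ((+ 2) * sumRes N m r (λ k → + catalan k))
    ≡[mod q ] ((+ 4) * sumRes N m r Bℤ - sumRes N m (r + + 1) Bℤ)
residue-sum-identities N m q r q∣Σs-Σ₁ =
  subst (q ∣_) (sym first) q∣Σs-Σ₁ , subst (q ∣_) (sym second) (∣m⇒∣-m q∣Σs-Σ₁)
  where
  open ≡-Reasoning
  Σs = sumRes N m r (λ k → Bℤ (suc k))
  Σ₁ = sumRes N m (r + + 1) Bℤ
  ΣB = sumRes N m r Bℤ
  cancel₁ : ∀ s s₁ b → (s - b) - (s₁ - b) ≡ s - s₁
  cancel₁ = solve-∀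
  cancel₂ : ∀ s s₁ b → (b - s) - (b - s₁) ≡ ℤ.- (s - s₁)
  cancel₂ = solve-∀
  first : (+ 2) * sumRes N m r (λ k → + nextToCentral k) - (Σ₁ - + 2 * ΣB) ≡ Σs - Σ₁
  first = begin
    + 2 * sumRes N m r (λ k → + nextToCentral k) - (Σ₁ - + 2 * ΣB)
      ≡⟨ cong (_- (Σ₁ - + 2 * ΣB)) (sym (sumRes-* N m r (+ 2) (λ k → + nextToCentral k))) ⟩
    sumRes N m r (λ k → + 2 * + nextToCentral k) - (Σ₁ - + 2 * ΣB)
      ≡⟨ cong (_- (Σ₁ - + 2 * ΣB)) (sumRes-cong N m r twice-nextToCentral) ⟩
    sumRes N m r (λ k → Bℤ (suc k) - + 2 * Bℤ k) - (Σ₁ - + 2 * ΣB)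
      ≡⟨ cong (_- (Σ₁ - + 2 * ΣB)) (trans (sumRes-- N m r _ _) (cong (Σs -_) (sumRes-* N m r (+ 2) Bℤ))) ⟩
    (Σs - + 2 * ΣB) - (Σ₁ - + 2 * ΣB)
      ≡⟨ cancel₁ Σs Σ₁ (+ 2 * ΣB) ⟩
    Σs - Σ₁ ∎
  second : (+ 2) * sumRes N m r (λ k → + catalan k) - (+ 4 * ΣB - Σ₁) ≡ ℤ.- (Σs - Σ₁)
  second = begin
    + 2 * sumRes N m r (λ k → + catalan k) - (+ 4 * ΣB - Σ₁)
      ≡⟨ cong (_- (+ 4 * ΣB - Σ₁)) (sym (sumRes-* N m r (+ 2) (λ k → + catalan k))) ⟩
    sumRes N m r (λ k → + 2 * + catalan k) - (+ 4 * ΣB - Σ₁)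
      ≡⟨ cong (_- (+ 4 * ΣB - Σ₁)) (sumRes-cong N m r twice-catalan) ⟩
    sumRes N m r (λ k → + 4 * Bℤ k - Bℤ (suc k)) - (+ 4 * ΣB - Σ₁)
      ≡⟨ cong (_- (+ 4 * ΣB - Σ₁)) (trans (sumRes-- N m r _ _) (cong (_- Σs) (sumRes-* N m r (+ 4) Bℤ))) ⟩
    (+ 4 * ΣB - Σs) - (+ 4 * ΣB - Σ₁)
      ≡⟨ cancel₂ Σs Σ₁ (+ 4 * ΣB) ⟩
    ℤ.- (Σs - Σ₁) ∎

central-mod-p² : ∀ {p} a → Prime p → + (p ^ 2) ∣ Bℤ (p ^ a) - Bℤ 1
central-mod-p² a pr with central-prime-power a pr
... | M , p²∣M , B≡2+M = subst (_ ∣_) (sym (trans (cong (λ z → + z - + 2) B≡2+M) (cancel (+ M)))) (∣ᵤ⇒∣ p²∣M)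
  where
  cancel : ∀ x → (+ 2 + x) - + 2 ≡ x
  cancel = solve-∀

lemma3p2 : (p a : ℕ) → Prime p → p ≢ 2 → 1 ℕ.≤ a → (r : ℤ) →
    let N = p ^ a
        m = + (p ℕ.∸ 1)
        q = + (p ^ 2)
        B : ℕ → ℤ
        B k = + ((2 ℕ.* k) C k)
    in ((+ 2) * sumRes N m r (λ k → + ((2 ℕ.* k) C (suc k))))
         ≡[mod q ] (sumRes N m (r + + 1) B - (+ 2) * sumRes N m r B)
       ×
       ((+ 2) * sumRes N m r (λ k → + catalan k))
         ≡[mod q ] ((+ 4) * sumRes N m r B - sumRes N m (r + + 1) B)
-- p = 0 is not prime; for p ≥ 1, m = p - 1 ∣ p^a - 1 and B (p^a) ≡ B 1 (mod p²),
-- so the index shift (2) applies and the identities (1) finish the proof.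
lemma3p2 zero    a pr _ _ r = contradiction refl (≢-nonZero⁻¹ 0 {{prime⇒nonZero pr}})
lemma3p2 (suc p) a pr _ _ r =
  residue-sum-identities (suc p ^ a) (+ p) (+ (suc p ^ 2)) r
    (shifted-sum-congruence (+ p) (+ (suc p ^ 2)) r Bℤ (suc p ^ a) (pred∣power-pred p a) (central-mod-p² a pr))
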